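{- The path $P_6$ (on $6$ vertices) is not line $[A,A]$-nice, i.e. Bob has a winning strategy in the $[A,A]$-edge colouring game on $P_6$ with $2$ colours.
   Context: In the $[A,A]$-edge colouring game with $k$ colours on a graph $G$, Alice and Bob alternately colour a previously uncoloured edge with one of $k$ colours so that edges sharing an endpoint get distinct colours; Alice moves first; Alice (only) may skip any of her moves. The game ends when no move is possible; Alice wins iff all edges are coloured. $G$ is line $[A,A]$-nice if the least $k$ for which Alice has a winning strategy equals the maximum number of pairwise adjacent edges of $G$ (which is $2$ for $P_6$). -}

module Defs where

open import Data.Nat using (ℕ; zero; suc; _<_; _≤_)
open import Data.Fin using (Fin; inject₁; _≟_) renaming (suc to fsuc)
open import Data.Fin.Properties using () renaming (_≟_ to _≟F_)
open import Data.List using (List; []; _∷_; length; map; allFin)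
open import Data.List.Relation.Unary.All using (All)
open import Data.List.Relation.Unary.AllPairs using (AllPairs)
open import Data.List.Relation.Unary.Unique.Propositional using (Unique)
open import Data.Maybe using (Maybe; just; nothing)
open import Data.Product using (Σ; _×_; _,_; ∃; ∃-syntax; proj₁; proj₂)
open import Data.Sum using (_⊎_)
open import Data.Empty using (⊥)
open import Relation.Nullary using (¬_; yes; no)
open import Relation.Binary.PropositionalEquality using (_≡_; _≢_)

-- A finite (multi)graph: vertex set Fin vertices, edges given as a list of
-- endpoint pairs.  Edges are identified by their index Fin (length edges).
record Graph : Set where
  field
    vertices : ℕ
    edges    : List (Fin vertices × Fin vertices)

open Graph public

Edge : Graph → Set
Edge G = Fin (length (edges G))

ends : (G : Graph) → Edge G → Fin (vertices G) × Fin (vertices G)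
ends G e = Data.List.lookup (edges G) e

ShareEnd : (G : Graph) → Edge G → Edge G → Set
ShareEnd G e f =
  (proj₁ (ends G e) ≡ proj₁ (ends G f)) ⊎ (proj₁ (ends G e) ≡ proj₂ (ends G f)) ⊎
  (proj₂ (ends G e) ≡ proj₁ (ends G f)) ⊎ (proj₂ (ends G e) ≡ proj₂ (ends G f))

Adjacent : (G : Graph) → Edge G → Edge G → Set
Adjacent G e f = e ≢ f × ShareEnd G e f

Path : ℕ → Graph
Path zero    = record { vertices = zero ; edges = [] }
Path (suc n) = record { vertices = suc n
                      ; edges = map (λ i → inject₁ i , fsuc i) (allFin n) }

Colouring : Graph → ℕ → Set
Colouring G k = Edge G → Maybe (Fin k)

emptyColouring : (G : Graph) (k : ℕ) → Colouring G k
emptyColouring G k _ = nothing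

Legal : (G : Graph) (k : ℕ) → Colouring G k → Edge G → Fin k → Set
Legal G k col e c =
  (col e ≡ nothing) × (∀ f → Adjacent G e f → col f ≢ just c)

HasMove : (G : Graph) (k : ℕ) → Colouring G k → Set
HasMove G k col = ∃[ e ] ∃[ c ] Legal G k col e c

Complete : (G : Graph) (k : ℕ) → Colouring G k → Set
Complete G k col = ∀ e → ∃[ c ] col e ≡ just c

update : (G : Graph) (k : ℕ) → Colouring G k → Edge G → Fin k → Colouring G k
update G k col e c f with f ≟F e
... | yes _ = just c
... | no  _ = col f

-- The game ends when no legal colouring move
-- exists; Alice wins iff then all edges are coloured.  Alice may skip
-- (only while the game has not ended); Bob may not skip.
-- AliceWinsA = Alice (to move) can force a win; AliceWinsB = same with Bob to move.
mutual
  data AliceWinsA (G : Graph) (k : ℕ) (col : Colouring G k) : Set where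
    a-end  : ¬ HasMove G k col → Complete G k col → AliceWinsA G k col
    a-move : (e : Edge G) (c : Fin k) → Legal G k col e c →
             AliceWinsB G k (update G k col e c) → AliceWinsA G k col
    a-skip : HasMove G k col → AliceWinsB G k col → AliceWinsA G k col

  data AliceWinsB (G : Graph) (k : ℕ) (col : Colouring G k) : Set where
    b-end  : ¬ HasMove G k col → Complete G k col → AliceWinsB G k col
    b-move : HasMove G k col →
             (∀ e c → Legal G k col e c → AliceWinsA G k (update G k col e c)) →
             AliceWinsB G k col

mutual
  data BobWinsA (G : Graph) (k : ℕ) (col : Colouring G k) : Set where
    a-end  : ¬ HasMove G k col → ¬ Complete G k col → BobWinsA G k col
    a-move : HasMove G k col →
             (∀ e c → Legal G k col e c → BobWinsB G k (update G k col e c)) →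
             BobWinsB G k col →          -- Alice's skip
             BobWinsA G k col

  data BobWinsB (G : Graph) (k : ℕ) (col : Colouring G k) : Set where
    b-end  : ¬ HasMove G k col → ¬ Complete G k col → BobWinsB G k col
    b-move : (e : Edge G) (c : Fin k) → Legal G k col e c →
             BobWinsA G k (update G k col e c) → BobWinsB G k col

AliceWins : Graph → ℕ → Set
AliceWins G k = AliceWinsA G k (emptyColouring G k)

BobWins : Graph → ℕ → Set
BobWins G k = BobWinsA G k (emptyColouring G k)

PairwiseAdjacent : (G : Graph) → List (Edge G) → Set
PairwiseAdjacent G es = AllPairs (Adjacent G) es

MaxPairwiseAdjacent : Graph → ℕ → Set
MaxPairwiseAdjacent G ω =
  (∃[ es ] PairwiseAdjacent G es × length es ≡ ω) ×
  (∀ es → PairwiseAdjacent G es → length es ≤ ω)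

LineAANice : Graph → Set
LineAANice G = ∃[ ω ] MaxPairwiseAdjacent G ω × AliceWins G ω ×
               (∀ k → k < ω → ¬ AliceWins G k)

-- In any graph, a position cannot be won by both players, so a winning
-- strategy for Bob with ω colours rules out line [A,A]-niceness as soon as ω
-- is the maximum number of pairwise adjacent edges.  In P_6 that maximum is 2,
-- because three edges of a path never pairwise share an endpoint.  Bob's win
-- with 2 colours on P_6 is a finite fact: every play colours an edge at least
-- every second move, so the game tree has depth at most 11 and is searched
-- exhaustively, the search building the strategy itself.
module Submission where

open import Defs
open import Data.Product using (_×_; ∃; _,_)
open import Relation.Nullary using (¬_; Dec; yes; no; ¬?)

open import Data.Nat using (ℕ; zero; suc; _≤_; z≤n; s≤s)
open import Data.Nat.Properties using (≤-antisym)
open import Data.Fin using (Fin) renaming (zero to fzero; suc to fsuc)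
open import Data.Fin.Properties using (all?; any?) renaming (_≟_ to _≟F_)
open import Data.List using ([]; _∷_; length)
open import Data.List.Relation.Unary.All using ([]; _∷_)
open import Data.List.Relation.Unary.AllPairs using ([]; _∷_)
open import Data.Maybe using (Maybe; just; nothing; from-just)
import Data.Maybe as Maybe
open import Data.Maybe.Properties using (≡-dec)
open import Data.Sum using (inj₁; inj₂)
open import Data.Empty using (⊥-elim)
open import Function using (_∘_; const)
open import Relation.Nullary.Decidable using (_×-dec_; _⊎-dec_; _→-dec_; dec⇒maybe; toWitness)
open import Relation.Binary.PropositionalEquality using (_≡_; refl)

mutual
  aliceWinsA⇒¬bobWinsA : ∀ {G k col} → AliceWinsA G k col → ¬ BobWinsA G k col
  aliceWinsA⇒¬bobWinsA (a-end _ done)     (a-end _ ¬done)      = ¬done done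
  aliceWinsA⇒¬bobWinsA (a-end stuck _)    (a-move move _ _)    = stuck move
  aliceWinsA⇒¬bobWinsA (a-move e c l _)   (a-end stuck _)      = stuck (e , c , l)
  aliceWinsA⇒¬bobWinsA (a-move e c l w)   (a-move _ reply _)   = aliceWinsB⇒¬bobWinsB w (reply e c l)
  aliceWinsA⇒¬bobWinsA (a-skip move _)    (a-end stuck _)      = stuck move
  aliceWinsA⇒¬bobWinsA (a-skip _ w)       (a-move _ _ onSkip)  = aliceWinsB⇒¬bobWinsB w onSkip

  aliceWinsB⇒¬bobWinsB : ∀ {G k col} → AliceWinsB G k col → ¬ BobWinsB G k col
  aliceWinsB⇒¬bobWinsB (b-end _ done)     (b-end _ ¬done)      = ¬done done
  aliceWinsB⇒¬bobWinsB (b-end stuck _)    (b-move e c l _)     = stuck (e , c , l)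
  aliceWinsB⇒¬bobWinsB (b-move move _)    (b-end stuck _)      = stuck move
  aliceWinsB⇒¬bobWinsB (b-move _ reply)   (b-move e c l w)     = aliceWinsA⇒¬bobWinsA (reply e c l) w

maxPairwiseAdjacent-unique : ∀ {G m n} →
  MaxPairwiseAdjacent G m → MaxPairwiseAdjacent G n → m ≡ n
maxPairwiseAdjacent-unique ((es , pa , refl) , bound) ((fs , pb , refl) , bound′) =
  ≤-antisym (bound′ es pa) (bound fs pb)

bobWins⇒¬lineAANice : ∀ {G ω} → MaxPairwiseAdjacent G ω → BobWins G ω → ¬ LineAANice G
bobWins⇒¬lineAANice {G} max bob (_ , max′ , alice , _)
  with refl ← maxPairwiseAdjacent-unique {G} max max′ = aliceWinsA⇒¬bobWinsA alice bob

NoAdjacentTriple : Graph → Set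
NoAdjacentTriple G = ∀ e f g → ¬ (Adjacent G e f × Adjacent G e g × Adjacent G f g)

noAdjacentTriple⇒length≤2 : ∀ {G} → NoAdjacentTriple G →
  ∀ es → PairwiseAdjacent G es → length es ≤ 2
noAdjacentTriple⇒length≤2 _ []            _ = z≤n
noAdjacentTriple⇒length≤2 _ (_ ∷ [])      _ = s≤s z≤n
noAdjacentTriple⇒length≤2 _ (_ ∷ _ ∷ [])  _ = s≤s (s≤s z≤n)
noAdjacentTriple⇒length≤2 triangleFree (e ∷ f ∷ g ∷ _) ((ef ∷ eg ∷ _) ∷ (fg ∷ _) ∷ _) =
  ⊥-elim (triangleFree e f g (ef , eg , fg))

module Decisions (G : Graph) where

  shareEnd? : ∀ e f → Dec (ShareEnd G e f)
  shareEnd? e f with ends G e | ends G f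
  ... | u , v | x , y = (u ≟F x) ⊎-dec (u ≟F y) ⊎-dec (v ≟F x) ⊎-dec (v ≟F y)

  adjacent? : ∀ e f → Dec (Adjacent G e f)
  adjacent? e f = ¬? (e ≟F f) ×-dec shareEnd? e f

  coloured? : ∀ {k} (m : Maybe (Fin k)) → Dec (∃ λ c → m ≡ just c)
  coloured? nothing  = no λ ()
  coloured? (just c) = yes (c , refl)

  legal? : ∀ {k} col e c → Dec (Legal G k col e c)
  legal? col e c =
    ≡-dec _≟F_ (col e) nothing ×-dec
    all? (λ f → adjacent? e f →-dec ¬? (≡-dec _≟F_ (col f) (just c)))

  hasMove? : ∀ {k} col → Dec (HasMove G k col)
  hasMove? col = any? λ e → any? λ c → legal? col e c

  complete? : ∀ {k} col → Dec (Complete G k col)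
  complete? col = all? λ e → coloured? (col e)

allFin? : ∀ {n} {P : Fin n → Set} → (∀ i → Maybe (P i)) → Maybe (∀ i → P i)
allFin? {zero}  _ = just λ ()
allFin? {suc n} {P} p = Maybe.zipWith cons (p fzero) (allFin? (p ∘ fsuc))
  where
  cons : P fzero → (∀ i → P (fsuc i)) → ∀ i → P i
  cons p₀ ps fzero    = p₀
  cons p₀ ps (fsuc i) = ps i

anyFin? : ∀ {n} {P : Fin n → Set} → (∀ i → Maybe (P i)) → Maybe (∃ P)
anyFin? {zero}  _ = nothing
anyFin? {suc n} p with p fzero
... | just p₀ = just (fzero , p₀)
... | nothing = Maybe.map (λ (i , pᵢ) → fsuc i , pᵢ) (anyFin? (p ∘ fsuc))

module Search (G : Graph) (k : ℕ) where
  open Decisions G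

  private
    assuming : ∀ {L P : Set} → Dec L → Maybe P → Maybe (L → P)
    assuming (yes _)  = Maybe.map const
    assuming (no ¬l) _ = just (⊥-elim ∘ ¬l)

    providing : ∀ {L P : Set} → Dec L → Maybe P → Maybe (L × P)
    providing (yes l) = Maybe.map (l ,_)
    providing (no _) _ = nothing

  mutual
    bobWinsA? : ℕ → ∀ col → Maybe (BobWinsA G k col)
    bobWinsA? zero    _   = nothing
    bobWinsA? (suc n) col with hasMove? col
    ... | no stuck = Maybe.map (a-end stuck) (dec⇒maybe (¬? (complete? col)))
    ... | yes move = Maybe.zipWith (a-move move)
      (allFin? λ e → allFin? λ c → assuming (legal? col e c) (bobWinsB? n (update G k col e c)))
      (bobWinsB? n col)

    bobWinsB? : ℕ → ∀ col → Maybe (BobWinsB G k col)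
    bobWinsB? zero    _   = nothing
    bobWinsB? (suc n) col with hasMove? col
    ... | no stuck = Maybe.map (b-end stuck) (dec⇒maybe (¬? (complete? col)))
    ... | yes _    = Maybe.map (λ (e , c , l , w) → b-move e c l w)
      (anyFin? λ e → anyFin? λ c → providing (legal? col e c) (bobWinsA? n (update G k col e c)))

bobWins-P₆ : BobWins (Path 6) 2
bobWins-P₆ = from-just (bobWinsA? 11 (emptyColouring (Path 6) 2))
  where open Search (Path 6) 2

maxPairwiseAdjacent-P₆ : MaxPairwiseAdjacent (Path 6) 2
maxPairwiseAdjacent-P₆ = ((fzero ∷ fsuc fzero ∷ []) , firstTwoAdjacent , refl)
                       , noAdjacentTriple⇒length≤2 noAdjacentTriple
  where
  open Decisions (Path 6)
  firstTwoAdjacent : PairwiseAdjacent (Path 6) (fzero ∷ fsuc fzero ∷ [])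
  firstTwoAdjacent = (((λ ()) , inj₂ (inj₂ (inj₁ refl))) ∷ []) ∷ [] ∷ []
  noAdjacentTriple : NoAdjacentTriple (Path 6)
  noAdjacentTriple = toWitness {a? = all? λ e → all? λ f → all? λ g →
    ¬? (adjacent? e f ×-dec adjacent? e g ×-dec adjacent? f g)} _

lemma42 : ¬ LineAANice (Path 6) × BobWins (Path 6) 2
lemma42 = bobWins⇒¬lineAANice maxPairwiseAdjacent-P₆ bobWins-P₆ , bobWins-P₆
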